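{- Let $N$ be a positive integer, let $a,b$ be integers with $0\leq a\leq b\leq N$, and let $j\geq 0$ be an integer with $\lfloor j^2/4\rfloor<N$ and $\lceil j/2\rceil<N$. Put $a_j=N^2-jN+\lfloor j^2/4\rfloor=(N-\lfloor j/2\rfloor)(N-\lceil j/2\rceil)$ and $b_{j-1}=N(N-j+1)$. Then \[ a_j\leq (N-a)(N-b)\leq b_{j-1} \] holds if and only if $(a,b)=(0,j-1)$ or $(a,b)=(\lfloor j/2\rfloor,\lceil j/2\rceil)$. -}

module Defs where

open import Data.Nat as ℕ using (ℕ; ⌊_/2⌋; ⌈_/2⌉)
open import Data.Integer as ℤ using (ℤ; +_; _-_; _*_; _+_)

⌊_²/4⌋ : ℕ → ℕ
⌊ j ²/4⌋ = (j ℕ.* j) ℕ./ 4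

aSeq : (N j : ℕ) → ℤ
aSeq N j = (+ N) * (+ N) - (+ j) * (+ N) + (+ ⌊ j ²/4⌋)

bPrev : (N j : ℕ) → ℤ
bPrev N j = (+ N) * ((+ N) - (+ j) + (+ 1))

-- Write s = a + b and F = ⌊j²/4⌋ = ⌊j/2⌋⌈j/2⌉. Since (N − a)(N − b) = N² − sN + ab, the two
-- inequalities read F + sN ≤ ab + jN ≤ (s + 1)N, and we compare s with j. If s < j the upper
-- bound forces ab = 0 and s + 1 = j, i.e. (a, b) = (0, j − 1). If s = j the lower bound says
-- ab ≥ F, while ⌊s/2⌋⌈s/2⌉ is the largest product of two naturals with sum s and is attained only
-- by the halves. If s = j + e with e > 0, then a = e + a' with a' + b = j, so
-- ab = eb + a'b ≤ eN + F; the lower bound F + eN ≤ ab makes this tight, forcing b = N and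
-- a'N = F < N, hence a' = 0, j = N and F = 0, which contradicts ⌈j/2⌉ < N.
module Submission where

open import Defs
open import Data.Nat as ℕ using (ℕ; ⌊_/2⌋; ⌈_/2⌉)
open import Data.Product using (_×_; _,_; proj₁; proj₂; uncurry)
open import Data.Sum using (_⊎_; inj₁; inj₂)
open import Relation.Binary.PropositionalEquality
  using (_≡_; refl; sym; trans; cong; cong₂; subst; subst₂; module ≡-Reasoning)
open import Function.Bundles using (_⇔_; mk⇔)

module OverNaturals where
  open import Data.Nat using (suc; _+_; _*_; _∸_; _/_; _≤_; _<_; z≤n; s≤s; z<s; NonZero)
  open import Data.Nat.Properties
  open import Data.Nat.DivMod using (/-congˡ; +-distrib-/-∣ʳ; m*n/n≡m)
  open import Data.Nat.Divisibility using (divides)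
  open import Data.Nat.Tactic.RingSolver using (solve-∀)
  open import Data.Empty using (⊥-elim)
  open import Relation.Nullary using (¬_; contradiction)
  open import Relation.Binary.Definitions using (tri<; tri≈; tri>)

  +-≤-squeeze : ∀ {m n o p} → m + n ≤ o + p → o ≤ m → p ≤ n → o ≡ m × p ≡ n
  +-≤-squeeze {m} {n} {o} {p} m+n≤o+p o≤m p≤n =
    ≤-antisym o≤m (+-cancelʳ-≤ n m o (≤-trans m+n≤o+p (+-monoʳ-≤ o p≤n))) ,
    ≤-antisym p≤n (+-cancelˡ-≤ m n p (≤-trans m+n≤o+p (+-monoˡ-≤ p o≤m)))

  ⌊n²/4⌋≡⌊n/2⌋*⌈n/2⌉ : ∀ n → ⌊ n ²/4⌋ ≡ ⌊ n /2⌋ * ⌈ n /2⌉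
  ⌊n²/4⌋≡⌊n/2⌋*⌈n/2⌉ 0 = refl
  ⌊n²/4⌋≡⌊n/2⌋*⌈n/2⌉ 1 = refl
  ⌊n²/4⌋≡⌊n/2⌋*⌈n/2⌉ (suc (suc n)) = begin
    (2 + n) * (2 + n) / 4            ≡⟨ /-congˡ (square-expand n) ⟩
    (n * n + suc n * 4) / 4          ≡⟨ +-distrib-/-∣ʳ (n * n) (divides (suc n) refl) ⟩
    ⌊ n ²/4⌋ + suc n * 4 / 4         ≡⟨ cong₂ _+_ (⌊n²/4⌋≡⌊n/2⌋*⌈n/2⌉ n) (m*n/n≡m (suc n) 4) ⟩
    h * c + suc n                    ≡⟨ cong (λ m → h * c + suc m) (sym (⌊n/2⌋+⌈n/2⌉≡n n)) ⟩
    h * c + suc (h + c)              ≡⟨ product-step h c ⟩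
    suc h * suc c                    ∎
    where
    open ≡-Reasoning
    h c : ℕ
    h = ⌊ n /2⌋
    c = ⌈ n /2⌉
    square-expand : ∀ n → (2 + n) * (2 + n) ≡ n * n + suc n * 4
    square-expand = solve-∀
    product-step : ∀ h c → h * c + suc (h + c) ≡ suc h * suc c
    product-step = solve-∀

  ⌈n/2⌉<n⇒0<⌊n²/4⌋ : ∀ {n} → ⌈ n /2⌉ < n → 0 < ⌊ n ²/4⌋
  ⌈n/2⌉<n⇒0<⌊n²/4⌋ {n} ⌈n/2⌉<n rewrite ⌊n²/4⌋≡⌊n/2⌋*⌈n/2⌉ n =
    *-mono-< 0<⌊n/2⌋ (<-≤-trans 0<⌊n/2⌋ (⌊n/2⌋≤⌈n/2⌉ n))
    where
    0<⌊n/2⌋ : 0 < ⌊ n /2⌋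
    0<⌊n/2⌋ = n≢0⇒n>0 λ ⌊n/2⌋≡0 →
      <-irrefl (trans (cong (_+ ⌈ n /2⌉) (sym ⌊n/2⌋≡0)) (⌊n/2⌋+⌈n/2⌉≡n n)) ⌈n/2⌉<n

  halves-of-m+[m+d] : ∀ m {d} → d ≤ 1 → m ≡ ⌊ m + (m + d) /2⌋ × m + d ≡ ⌈ m + (m + d) /2⌉
  halves-of-m+[m+d] m z≤n rewrite +-identityʳ m = n≡⌊n+n/2⌋ m , n≡⌈n+n/2⌉ m
  halves-of-m+[m+d] m (s≤s z≤n) rewrite +-comm m 1 | +-suc m m =
    n≡⌈n+n/2⌉ m , cong suc (n≡⌊n+n/2⌋ m)

  m*[m+d]≡⌊[m+[m+d]]²/4⌋ : ∀ m {d} → d ≤ 1 → m * (m + d) ≡ ⌊ (m + (m + d)) ²/4⌋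
  m*[m+d]≡⌊[m+[m+d]]²/4⌋ m {d} d≤1 =
    trans (uncurry (cong₂ _*_) (halves-of-m+[m+d] m d≤1)) (sym (⌊n²/4⌋≡⌊n/2⌋*⌈n/2⌉ (m + (m + d))))

  m*[m+d]≤⌊[m+[m+d]]²/4⌋ : ∀ m d → m * (m + d) ≤ ⌊ (m + (m + d)) ²/4⌋
  m*[m+2+d]<⌊[m+[m+2+d]]²/4⌋ : ∀ m d → m * (m + (2 + d)) < ⌊ (m + (m + (2 + d))) ²/4⌋

  m*[m+d]≤⌊[m+[m+d]]²/4⌋ m 0 = ≤-reflexive (m*[m+d]≡⌊[m+[m+d]]²/4⌋ m z≤n)
  m*[m+d]≤⌊[m+[m+d]]²/4⌋ m 1 = ≤-reflexive (m*[m+d]≡⌊[m+[m+d]]²/4⌋ m (s≤s z≤n))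
  m*[m+d]≤⌊[m+[m+d]]²/4⌋ m (suc (suc d)) = <⇒≤ (m*[m+2+d]<⌊[m+[m+2+d]]²/4⌋ m d)

  -- Moving one unit from the larger factor to the smaller one increases the product.
  m*[m+2+d]<⌊[m+[m+2+d]]²/4⌋ m d = begin-strict
    m * (m + (2 + d))                    <⟨ m<n+m _ {suc d} z<s ⟩
    suc d + m * (m + (2 + d))            ≡⟨ balance m d ⟩
    suc m * (suc m + d)                  ≤⟨ m*[m+d]≤⌊[m+[m+d]]²/4⌋ (suc m) d ⟩
    ⌊ (suc m + (suc m + d)) ²/4⌋         ≡⟨ cong ⌊_²/4⌋ (same-sum m d) ⟩
    ⌊ (m + (m + (2 + d))) ²/4⌋           ∎
    where
    open ≤-Reasoning
    balance : ∀ m d → suc d + m * (m + (2 + d)) ≡ suc m * (suc m + d)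
    balance = solve-∀
    same-sum : ∀ m d → suc m + (suc m + d) ≡ m + (m + (2 + d))
    same-sum = solve-∀

  ⌊[m+[m+d]]²/4⌋≤m*[m+d]⇒d≤1 : ∀ m d → ⌊ (m + (m + d)) ²/4⌋ ≤ m * (m + d) → d ≤ 1
  ⌊[m+[m+d]]²/4⌋≤m*[m+d]⇒d≤1 m 0 _ = z≤n
  ⌊[m+[m+d]]²/4⌋≤m*[m+d]⇒d≤1 m 1 _ = s≤s z≤n
  ⌊[m+[m+d]]²/4⌋≤m*[m+d]⇒d≤1 m (suc (suc d)) ⌊²/4⌋≤ =
    contradiction ⌊²/4⌋≤ (<⇒≱ (m*[m+2+d]<⌊[m+[m+2+d]]²/4⌋ m d))

  m*n≤⌊[m+n]²/4⌋ : ∀ {m n} → m ≤ n → m * n ≤ ⌊ (m + n) ²/4⌋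
  m*n≤⌊[m+n]²/4⌋ {m} m≤n with d , refl ← m≤n⇒∃[o]m+o≡n m≤n = m*[m+d]≤⌊[m+[m+d]]²/4⌋ m d

  ⌊[m+n]²/4⌋≤m*n⇒halves : ∀ {m n} → m ≤ n → ⌊ (m + n) ²/4⌋ ≤ m * n →
                          m ≡ ⌊ m + n /2⌋ × n ≡ ⌈ m + n /2⌉
  ⌊[m+n]²/4⌋≤m*n⇒halves {m} m≤n ⌊²/4⌋≤ with d , refl ← m≤n⇒∃[o]m+o≡n m≤n =
    halves-of-m+[m+d] m (⌊[m+[m+d]]²/4⌋≤m*[m+d]⇒d≤1 m d ⌊²/4⌋≤)

  below-diagonal : ∀ {N a b j} .{{_ : NonZero N}} → a ≤ b → a + b < j →
                   a * b + j * N ≤ suc (a + b) * N → a ≡ 0 × suc b ≡ j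
  below-diagonal {N} {a} {b} {j} a≤b a+b<j upper =
    a≡0 , *-cancelʳ-≡ (suc b) j N (subst (λ x → suc (x + b) * N ≡ j * N) a≡0 (proj₂ tight))
    where
    tight : 0 ≡ a * b × suc (a + b) * N ≡ j * N
    tight = +-≤-squeeze upper z≤n (*-monoˡ-≤ N a+b<j)
    a≡0 : a ≡ 0
    a≡0 with m*n≡0⇒m≡0∨n≡0 a (sym (proj₁ tight))
    ... | inj₁ a≡0 = a≡0
    ... | inj₂ b≡0 = n≤0⇒n≡0 (subst (a ≤_) b≡0 a≤b)

  excess-impossible : ∀ {N a b j e} .{{_ : NonZero N}} → a ≤ b → b ≤ N →
                      ⌊ j ²/4⌋ < N → ⌈ j /2⌉ < N → a + b ≡ j + suc e →
                      ¬ (⌊ j ²/4⌋ + suc e * N ≤ a * b)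
  excess-impossible {N} {a} {b} {j} {e} a≤b b≤N F<N ⌈j/2⌉<N a+b≡j+E excess =
    contradiction F≡0 (>⇒≢ (⌈n/2⌉<n⇒0<⌊n²/4⌋ (subst (⌈ j /2⌉ <_) N≡j ⌈j/2⌉<N)))
    where
    F E : ℕ
    F = ⌊ j ²/4⌋
    E = suc e
    E≤a : E ≤ a
    E≤a = *-cancelʳ-≤ E a N (≤-trans (m+n≤o⇒n≤o F excess) (*-monoʳ-≤ a b≤N))
    a′ : ℕ
    a′ = a ∸ E
    E+a′≡a : E + a′ ≡ a
    E+a′≡a = m+[n∸m]≡n E≤a
    a′+b≡j : a′ + b ≡ j
    a′+b≡j = +-cancelˡ-≡ E _ _ (begin
      E + (a′ + b)  ≡⟨ sym (+-assoc E a′ b) ⟩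
      E + a′ + b    ≡⟨ cong (_+ b) E+a′≡a ⟩
      a + b         ≡⟨ a+b≡j+E ⟩
      j + E         ≡⟨ +-comm j E ⟩
      E + j         ∎)
      where open ≡-Reasoning
    a′b≤F : a′ * b ≤ F
    a′b≤F = subst (λ k → a′ * b ≤ ⌊ k ²/4⌋) a′+b≡j (m*n≤⌊[m+n]²/4⌋ (≤-trans (m∸n≤m a E) a≤b))
    ab≡a′b+Eb : a * b ≡ a′ * b + E * b
    ab≡a′b+Eb = trans (cong (_* b) (trans (sym E+a′≡a) (+-comm E a′))) (*-distribʳ-+ b a′ E)
    tight : a′ * b ≡ F × E * b ≡ E * N
    tight = +-≤-squeeze (subst (F + E * N ≤_) ab≡a′b+Eb excess) a′b≤F (*-monoʳ-≤ E b≤N)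
    b≡N : b ≡ N
    b≡N = *-cancelˡ-≡ b N E (proj₂ tight)
    a′≡0 : a′ ≡ 0
    a′≡0 = n<1⇒n≡0 (*-cancelʳ-< N a′ 1 (begin-strict
      a′ * N  ≡⟨ cong (a′ *_) (sym b≡N) ⟩
      a′ * b  ≡⟨ proj₁ tight ⟩
      F       <⟨ F<N ⟩
      N       ≡⟨ sym (*-identityˡ N) ⟩
      1 * N   ∎))
      where open ≤-Reasoning
    N≡j : N ≡ j
    N≡j = trans (sym b≡N) (subst (λ x → x + b ≡ j) a′≡0 a′+b≡j)
    F≡0 : F ≡ 0
    F≡0 = trans (sym (proj₁ tight)) (cong (_* b) a′≡0)

  above-diagonal : ∀ {N a b j} .{{_ : NonZero N}} → a ≤ b → b ≤ N →
                   ⌊ j ²/4⌋ < N → ⌈ j /2⌉ < N → j < a + b →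
                   ¬ (⌊ j ²/4⌋ + (a + b) * N ≤ a * b + j * N)
  above-diagonal {N} {a} {b} {j} a≤b b≤N F<N ⌈j/2⌉<N j<a+b lower =
    excess-impossible a≤b b≤N F<N ⌈j/2⌉<N a+b≡j+E (+-cancelˡ-≤ (j * N) _ _ (begin
      j * N + (F + E * N)  ≡⟨ regroup F j E N ⟩
      F + (j + E) * N      ≡⟨ cong (λ s → F + s * N) (sym a+b≡j+E) ⟩
      F + (a + b) * N      ≤⟨ lower ⟩
      a * b + j * N        ≡⟨ +-comm (a * b) (j * N) ⟩
      j * N + a * b        ∎))
    where
    open ≤-Reasoning
    F E : ℕ
    F = ⌊ j ²/4⌋
    E = suc (a + b ∸ suc j)
    a+b≡j+E : a + b ≡ j + E
    a+b≡j+E = trans (sym (m+[n∸m]≡n j<a+b)) (sym (+-suc j _))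
    regroup : ∀ F j E N → j * N + (F + E * N) ≡ F + (j + E) * N
    regroup = solve-∀

  bounds⇒solution : ∀ {N a b j} .{{_ : NonZero N}} → a ≤ b → b ≤ N →
                    ⌊ j ²/4⌋ < N → ⌈ j /2⌉ < N →
                    ⌊ j ²/4⌋ + (a + b) * N ≤ a * b + j * N → a * b + j * N ≤ suc (a + b) * N →
                    (a ≡ 0 × suc b ≡ j) ⊎ (a ≡ ⌊ j /2⌋ × b ≡ ⌈ j /2⌉)
  bounds⇒solution {N} {a} {b} {j} a≤b b≤N F<N ⌈j/2⌉<N lower upper with <-cmp (a + b) j
  ... | tri< a+b<j _ _ = inj₁ (below-diagonal a≤b a+b<j upper)
  ... | tri≈ _ refl _ =
    inj₂ (⌊[m+n]²/4⌋≤m*n⇒halves a≤b (+-cancelʳ-≤ ((a + b) * N) ⌊ (a + b) ²/4⌋ (a * b) lower))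
  ... | tri> _ _ j<a+b = ⊥-elim (above-diagonal a≤b b≤N F<N ⌈j/2⌉<N j<a+b lower)

  solution⇒bounds : ∀ {N a b j} → ⌊ j ²/4⌋ < N →
                    (a ≡ 0 × suc b ≡ j) ⊎ (a ≡ ⌊ j /2⌋ × b ≡ ⌈ j /2⌉) →
                    ⌊ j ²/4⌋ + (a + b) * N ≤ a * b + j * N × a * b + j * N ≤ suc (a + b) * N
  solution⇒bounds {N} {b = b} F<N (inj₁ (refl , refl)) = +-monoˡ-≤ (b * N) (<⇒≤ F<N) , ≤-refl
  solution⇒bounds {N} {j = j} F<N (inj₂ (refl , refl))
    rewrite ⌊n/2⌋+⌈n/2⌉≡n j | sym (⌊n²/4⌋≡⌊n/2⌋*⌈n/2⌉ j) = ≤-refl , +-monoˡ-≤ (j * N) (<⇒≤ F<N)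

  bounds⇔solution : ∀ {N a b j} .{{_ : NonZero N}} → a ≤ b → b ≤ N →
                    ⌊ j ²/4⌋ < N → ⌈ j /2⌉ < N →
                    (⌊ j ²/4⌋ + (a + b) * N ≤ a * b + j * N × a * b + j * N ≤ suc (a + b) * N)
                      ⇔ ((a ≡ 0 × suc b ≡ j) ⊎ (a ≡ ⌊ j /2⌋ × b ≡ ⌈ j /2⌉))
  bounds⇔solution a≤b b≤N F<N ⌈j/2⌉<N =
    mk⇔ (uncurry (bounds⇒solution a≤b b≤N F<N ⌈j/2⌉<N)) (solution⇒bounds F<N)

open OverNaturals using (bounds⇔solution)
open import Data.Nat using (suc; NonZero; >-nonZero)
open import Data.Integer as ℤ using (ℤ; +_; _+_; _-_; _*_; _≤_; +≤+)
open import Data.Integer.Properties using (+-monoˡ-≤; drop‿+≤+; pos-*; +-injective)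
open import Data.Integer.Tactic.RingSolver using (solve-∀)
open import Data.Product.Function.NonDependent.Propositional using (_×-⇔_)
open import Data.Sum.Function.Propositional using (_⊎-⇔_)
open import Function.Construct.Composition using (_⇔-∘_)
open import Function.Construct.Identity using (⇔-id)

≤⇔≤ℕ-via-shift : ∀ {x y : ℤ} (z : ℤ) {m n} → x + z ≡ + m → y + z ≡ + n → x ≤ y ⇔ m ℕ.≤ n
≤⇔≤ℕ-via-shift {x} {y} z x+z≡m y+z≡n = mk⇔
  (λ x≤y → drop‿+≤+ (subst₂ _≤_ x+z≡m y+z≡n (+-monoˡ-≤ z x≤y)))
  (λ m≤n → subst₂ _≤_ (unshift x z) (unshift y z)
    (+-monoˡ-≤ (ℤ.- z) (subst₂ _≤_ (sym x+z≡m) (sym y+z≡n) (+≤+ m≤n))))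
  where
  unshift : ∀ w z → w + z - z ≡ w
  unshift = solve-∀

shift : (N a b j : ℕ) → ℤ
shift N a b j = (+ a + + b) * + N + + j * + N - + N * + N

aSeq+shift : ∀ N a b j → aSeq N j + shift N a b j ≡ + (⌊ j ²/4⌋ ℕ.+ (a ℕ.+ b) ℕ.* N)
aSeq+shift N a b j =
  trans (identity (+ N) (+ j) (+ ⌊ j ²/4⌋) (+ a + + b)) (cong (λ x → + ⌊ j ²/4⌋ + x) (sym (pos-* (a ℕ.+ b) N)))
  where
  identity : ∀ n j f s → (n * n - j * n + f) + (s * n + j * n - n * n) ≡ f + s * n
  identity = solve-∀

product+shift : ∀ N a b j → (+ N - + a) * (+ N - + b) + shift N a b j ≡ + (a ℕ.* b ℕ.+ j ℕ.* N)
product+shift N a b j =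
  trans (identity (+ N) (+ a) (+ b) (+ j)) (sym (cong₂ _+_ (pos-* a b) (pos-* j N)))
  where
  identity : ∀ n a b j → (n - a) * (n - b) + ((a + b) * n + j * n - n * n) ≡ a * b + j * n
  identity = solve-∀

bPrev+shift : ∀ N a b j → bPrev N j + shift N a b j ≡ + (suc (a ℕ.+ b) ℕ.* N)
bPrev+shift N a b j =
  trans (identity (+ N) (+ j) (+ a + + b)) (cong (λ x → + N + x) (sym (pos-* (a ℕ.+ b) N)))
  where
  identity : ∀ n j s → n * (n - j + + 1) + (s * n + j * n - n * n) ≡ n + s * n
  identity = solve-∀

1+m≡n⇔+m≡+n-1 : ∀ {m n} → suc m ≡ n ⇔ + m ≡ + n - + 1
1+m≡n⇔+m≡+n-1 {m} {n} = mk⇔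
  (λ { refl → sym (sub-add (+ m)) })
  (λ m≡n-1 → +-injective (trans (cong (λ x → + 1 + x) m≡n-1) (add-sub (+ n))))
  where
  add-sub : ∀ x → + 1 + (x - + 1) ≡ x
  add-sub = solve-∀
  sub-add : ∀ x → + 1 + x - + 1 ≡ x
  sub-add = solve-∀

ℤ-bounds⇔ℕ-bounds : ∀ N a b j →
  (aSeq N j ≤ (+ N - + a) * (+ N - + b) × (+ N - + a) * (+ N - + b) ≤ bPrev N j)
    ⇔ (⌊ j ²/4⌋ ℕ.+ (a ℕ.+ b) ℕ.* N ℕ.≤ a ℕ.* b ℕ.+ j ℕ.* N × a ℕ.* b ℕ.+ j ℕ.* N ℕ.≤ suc (a ℕ.+ b) ℕ.* N)
ℤ-bounds⇔ℕ-bounds N a b j =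
  ≤⇔≤ℕ-via-shift (shift N a b j) (aSeq+shift N a b j) (product+shift N a b j)
  ×-⇔ ≤⇔≤ℕ-via-shift (shift N a b j) (product+shift N a b j) (bPrev+shift N a b j)

ℕ-solution⇔ℤ-solution : ∀ {a b j} →
  ((a ≡ 0 × suc b ≡ j) ⊎ (a ≡ ⌊ j /2⌋ × b ≡ ⌈ j /2⌉))
    ⇔ ((+ a ≡ + 0 × + b ≡ + j - + 1) ⊎ (a ≡ ⌊ j /2⌋ × b ≡ ⌈ j /2⌉))
ℕ-solution⇔ℤ-solution = (mk⇔ (cong (λ n → + n)) +-injective ×-⇔ 1+m≡n⇔+m≡+n-1) ⊎-⇔ ⇔-id _

lemma4p3 : (N a b j : ℕ) → 0 ℕ.< N → a ℕ.≤ b → b ℕ.≤ N →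
  ⌊ j ²/4⌋ ℕ.< N → ⌈ j /2⌉ ℕ.< N →
  ((aSeq N j ≤ ((+ N) - (+ a)) * ((+ N) - (+ b))) × (((+ N) - (+ a)) * ((+ N) - (+ b)) ≤ bPrev N j))
    ⇔ (((+ a) ≡ (+ 0) × (+ b) ≡ (+ j) - (+ 1)) ⊎ (a ≡ ⌊ j /2⌋ × b ≡ ⌈ j /2⌉))
lemma4p3 N a b j 0<N a≤b b≤N F<N ⌈j/2⌉<N =
  ℕ-solution⇔ℤ-solution ⇔-∘ (bounds⇔solution a≤b b≤N F<N ⌈j/2⌉<N ⇔-∘ ℤ-bounds⇔ℕ-bounds N a b j)
  where
  instance
    N≢0 : NonZero N
    N≢0 = >-nonZero 0<N
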